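{- Let $f\in\mathcal F$ be of powerfree-type, defined via $(\varepsilon_j)$, and let $k$ be the smallest positive integer such that $\varepsilon_k\ne1$. Then the critical index of $f$ equals $k$. Moreover, for $\sigma>1$, \[ D_f(s)=\frac{\zeta(s)}{\zeta(ks)^{1+|\varepsilon_k|}}\Bigl(\prod_{j=k+1}^{2k-1}\zeta(js)^{\varepsilon_j-\varepsilon_{j-1}}\Bigr)\zeta(2ks)^{\varepsilon_{2k}-\varepsilon_{2k-1}-|\varepsilon_k|}U_{2k}(s), \] where $U_{2k}(s)=\prod_p\bigl(1+\sum_{j=2k+1}^\infty\eta_jp^{ -js}\bigr)$ has the property that there exist $A,B>0$ such that $|\eta_j|\le(Aj)^B$ for all $j$.
   Context: A fake $\mu$ is a multiplicative arithmetic function $f$ for which there is a sequence $(\varepsilon_j)_{j\ge1}$ with each $\varepsilon_j\in\{ -1,0,1\}$ such that $f(p^j)=\varepsilon_j$ for every prime $p$ and every $j\ge1$. Let $\mathcal{F}$ be the set of fake $\mu$'s that are neither the indicator function of $\{1\}$ nor the indicator function of the set of $k$th powers for any $k\ge1$. For $f\in\mathcal F$, $D_f(s)=\sum_{n\ge1}f(n)n^{ -s}$ ($\sigma>1$). $f$ is of powerfree-type if $\varepsilon_1=1$. There is a unique sequence of integers $(a_j)_{j\ge1}$ with $1+\sum_{j\ge1}\varepsilon_jX^j=\prod_{j\ge1}(1-X^j)^{ -a_j}$ as formal power series (equivalently, for each $L$, $D_f(s)=\prod_{j=1}^{L}\zeta(js)^{a_j}\prod_p(1+\sum_{j\ge L+1}\eta_jp^{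 -js})$ for $\sigma>1$). The critical index of $f$ is the least $\ell$ with $a_\ell<0$. -}

module Defs where

open import Data.Nat as ℕ using (ℕ; zero; suc)
open import Data.Nat.Divisibility using (_∣_; _∣?_)
open import Data.Integer as ℤ using (ℤ; +_; -[1+_])
open import Data.Product using (_×_; ∃-syntax)
open import Data.Sum using (_⊎_)
open import Relation.Nullary using (¬_; yes; no)
open import Relation.Binary.PropositionalEquality using (_≡_)

PS : Set
PS = ℕ → ℤ

sumTo : ℕ → (ℕ → ℤ) → ℤ
sumTo zero    g = g 0
sumTo (suc n) g = sumTo n g ℤ.+ g (suc n)

infixl 7 _⊛_
_⊛_ : PS → PS → PS
(f ⊛ g) n = sumTo n (λ i → f i ℤ.* g (n ℕ.∸ i))

onePS : PS
onePS zero    = + 1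
onePS (suc _) = + 0

powPS : PS → ℕ → PS
powPS f zero    = onePS
powPS f (suc m) = f ⊛ powPS f m

-- geo j = (1 - X^j)^(-1) = Σ_m X^(j m)   (used for j ≥ 1)
geo : ℕ → PS
geo j n with j ∣? n
... | yes _ = + 1
... | no  _ = + 0

-- oneMinus j = 1 - X^j   (used for j ≥ 1)
oneMinus : ℕ → PS
oneMinus j zero = + 1
oneMinus j (suc n) with suc n ℕ.≟ j
... | yes _ = -[1+ 0 ]
... | no  _ = + 0

-- factor j a = (1 - X^j)^(-a)
factor : ℕ → ℤ → PS
factor j (+ m)     = powPS (geo j) m
factor j -[1+ m ]  = powPS (oneMinus j) (suc m)

prodFactors : (ℕ → ℤ) → ℕ → PS
prodFactors a zero    = onePS
prodFactors a (suc L) = prodFactors a L ⊛ factor (suc L) (a (suc L))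

-- The sequence (ε_j)_{j ≥ 1} is encoded as ε : ℕ → ℤ; the value ε 0 is ignored.
-- seriesOf ε = 1 + Σ_{j ≥ 1} ε_j X^j  (the common local Euler factor of D_f at X = p^{-s})
seriesOf : (ℕ → ℤ) → PS
seriesOf ε zero    = + 1
seriesOf ε (suc n) = ε (suc n)

IsSignSeq : (ℕ → ℤ) → Set
IsSignSeq ε = ∀ j → 1 ℕ.≤ j → (ε j ≡ -[1+ 0 ]) ⊎ (ε j ≡ + 0) ⊎ (ε j ≡ + 1)

IsIndicatorOfOne : (ℕ → ℤ) → Set
IsIndicatorOfOne ε = ∀ j → 1 ℕ.≤ j → ε j ≡ + 0

IsIndicatorOfPowers : (ℕ → ℤ) → ℕ → Set
IsIndicatorOfPowers ε k =
  ∀ j → 1 ℕ.≤ j → (k ∣ j → ε j ≡ + 1) × (¬ (k ∣ j) → ε j ≡ + 0)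

InF : (ℕ → ℤ) → Set
InF ε = IsSignSeq ε × ¬ IsIndicatorOfOne ε
        × (∀ k → 1 ℕ.≤ k → ¬ IsIndicatorOfPowers ε k)

PowerfreeType : (ℕ → ℤ) → Set
PowerfreeType ε = ε 1 ≡ + 1

-- a is the (unique) exponent sequence: 1 + Σ ε_j X^j = ∏_{j ≥ 1} (1 - X^j)^(-a_j)
-- as formal power series (coefficient n of the infinite product is that of any
-- truncation ∏_{j ≤ L} with L ≥ n).
IsExponentSeq : (ℕ → ℤ) → (ℕ → ℤ) → Set
IsExponentSeq ε a = ∀ L n → n ℕ.≤ L → prodFactors a L n ≡ seriesOf ε n

IsCriticalIndex : (ℕ → ℤ) → ℕ → Set
IsCriticalIndex a ℓ = 1 ℕ.≤ ℓ × a ℓ ℤ.< + 0 × (∀ j → 1 ℕ.≤ j → j ℕ.< ℓ → + 0 ℤ.≤ a j)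

tailSeries : ℕ → (ℕ → ℤ) → PS
tailSeries L η zero = + 1
tailSeries L η (suc n) with suc n ℕ.≤? L
... | yes _ = + 0
... | no  _ = η (suc n)

-- 1 + Σ ε_j X^j = ∏_{j=1}^{L} (1 - X^j)^(-a_j) · (1 + Σ_{j ≥ L+1} η_j X^j),
-- i.e. D_f(s) = ∏_{j ≤ L} ζ(js)^{a_j} ∏_p (1 + Σ_{j ≥ L+1} η_j p^{-js})
IsTailFactorization : (ℕ → ℤ) → (ℕ → ℤ) → ℕ → (ℕ → ℤ) → Set
IsTailFactorization ε a L η = ∀ n → (prodFactors a L ⊛ tailSeries L η) n ≡ seriesOf ε n

-- Write P_L = ∏_{j ≤ L} (1 − X^j)^(−a_j). Below degree 2(L+1) the factor (1 − X^(L+1))^(−a_(L+1))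
-- agrees with 1 + a_(L+1) X^(L+1), so [X^n] P_(L+1) = [X^n] P_L + a_(L+1) [X^(n−L−1)] P_L there; at
-- n = L+1 this is the recurrence a_(L+1) = ε_(L+1) − [X^(L+1)] P_L. While ε_j = 1 it gives a_1 = 1,
-- a_j = 0 and P_(k−1) = 1/(1 − X). Then a_k = ε_k − 1 = −(1 + |ε_k|), and P_k = (1 − X^k)^(1+|ε_k|)/(1 − X)
-- has coefficients ε_k on (k, 2k), and ε_k + |ε_k| at 2k. This shape persists for P_m, k ≤ m < 2k, on
-- (m, 2k] with ε_m in place of ε_k, which yields a_j = ε_j − ε_(j−1) for k < j < 2k and the extra
-- −|ε_k| at 2k. The tail series is P_(2k)^(−1) (1 + Σ ε_j X^j), a finite product of series with
-- coefficients in {−1, 0, 1}, and bounds of the form (D (n+1))^D are stable under products.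

module Submission where

open import Defs
open import Data.Nat as ℕ using (ℕ; zero; suc; _*_; _^_; z≤n; s≤s)
import Data.Nat.Properties as ℕP
open import Data.Integer as ℤ using (ℤ; +_; -[1+_]; ∣_∣; _+_; _-_; -_)
import Data.Integer.Properties as ℤP
open import Data.Integer.Tactic.RingSolver using (solve-∀)
open import Algebra.Properties.CommutativeSemigroup ℤP.+-commutativeSemigroup using (interchange)
open import Data.Nat.Divisibility using (_∣_; _∣?_; divides; 1∣_; ∣-refl; ∣m+n∣m⇒∣n; ∣m∸n∣n⇒∣m)
open import Data.Product using (_×_; _,_; ∃-syntax)
open import Data.Sum using (_⊎_; inj₁; inj₂)
open import Data.Empty using (⊥-elim)
open import Function using (_∘_)
open import Relation.Nullary using (yes; no)
open import Relation.Binary.PropositionalEquality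
open ≡-Reasoning

-- Finite sums and the Cauchy product

sumTo-cong : ∀ n {g h : ℕ → ℤ} → (∀ i → i ℕ.≤ n → g i ≡ h i) → sumTo n g ≡ sumTo n h
sumTo-cong zero    g≡h = g≡h 0 z≤n
sumTo-cong (suc n) g≡h =
  cong₂ _+_ (sumTo-cong n (λ i i≤n → g≡h i (ℕP.m≤n⇒m≤1+n i≤n))) (g≡h (suc n) ℕP.≤-refl)

sumTo-+ : ∀ n (g h : ℕ → ℤ) → sumTo n (λ i → g i + h i) ≡ sumTo n g + sumTo n h
sumTo-+ zero    g h = refl
sumTo-+ (suc n) g h = begin
  sumTo n (λ i → g i + h i) + (g (suc n) + h (suc n))
    ≡⟨ cong (ℤ._+ (g (suc n) + h (suc n))) (sumTo-+ n g h) ⟩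
  (sumTo n g + sumTo n h) + (g (suc n) + h (suc n))
    ≡⟨ interchange (sumTo n g) (sumTo n h) _ _ ⟩
  sumTo (suc n) g + sumTo (suc n) h ∎

sumTo-*ˡ : ∀ n c (g : ℕ → ℤ) → sumTo n (λ i → c ℤ.* g i) ≡ c ℤ.* sumTo n g
sumTo-*ˡ zero    c g = refl
sumTo-*ˡ (suc n) c g =
  trans (cong (ℤ._+ c ℤ.* g (suc n)) (sumTo-*ˡ n c g)) (sym (ℤP.*-distribˡ-+ c _ _))

sumTo-suc : ∀ n (g : ℕ → ℤ) → sumTo (suc n) g ≡ g 0 + sumTo n (g ∘ suc)
sumTo-suc zero    g = refl
sumTo-suc (suc n) g =
  trans (cong (ℤ._+ g (suc (suc n))) (sumTo-suc n g)) (ℤP.+-assoc (g 0) _ _)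

sumTo-reverse : ∀ n (g : ℕ → ℤ) → sumTo n g ≡ sumTo n (λ i → g (n ℕ.∸ i))
sumTo-reverse zero    g = refl
sumTo-reverse (suc n) g = begin
  sumTo n g + g (suc n)                         ≡⟨ ℤP.+-comm (sumTo n g) (g (suc n)) ⟩
  g (suc n) + sumTo n g                         ≡⟨ cong (_+_ (g (suc n))) (sumTo-reverse n g) ⟩
  g (suc n) + sumTo n (λ i → g (n ℕ.∸ i))       ≡⟨ sym (sumTo-suc n (λ i → g (suc n ℕ.∸ i))) ⟩
  sumTo (suc n) (λ i → g (suc n ℕ.∸ i))           ∎

infixl 6 _⊕_
infixr 7 _·_

_⊕_ : PS → PS → PS
(f ⊕ g) n = f n + g n

_·_ : ℤ → PS → PS
(c · f) n = c ℤ.* f n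

X^_ : ℕ → PS
(X^ t) i with i ℕ.≟ t
... | yes _ = + 1
... | no  _ = + 0

X^-self : ∀ t → (X^ t) t ≡ + 1
X^-self t with t ℕ.≟ t
... | yes _   = refl
... | no  t≢t = ⊥-elim (t≢t refl)

X^-≢ : ∀ {t i} → i ≢ t → (X^ t) i ≡ + 0
X^-≢ {t} {i} i≢t with i ℕ.≟ t
... | yes i≡t = ⊥-elim (i≢t i≡t)
... | no  _   = refl

X^-< : ∀ {t i} → i ℕ.< t → (X^ t) i ≡ + 0
X^-< i<t = X^-≢ (ℕP.<⇒≢ i<t)

onePS≗X^0 : onePS ≗ X^ 0
onePS≗X^0 zero    = sym (X^-self 0)
onePS≗X^0 (suc n) = sym (X^-≢ {0} {suc n} λ ())

sumTo-X^-< : ∀ n t (h : ℕ → ℤ) → n ℕ.< t → sumTo n (λ i → (X^ t) i ℤ.* h i) ≡ + 0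
sumTo-X^-< zero    t h 0<t = cong (ℤ._* h 0) (X^-< 0<t)
sumTo-X^-< (suc n) t h n<t =
  cong₂ (λ s x → s + x ℤ.* h (suc n)) (sumTo-X^-< n t h (ℕP.<-trans (ℕP.n<1+n n) n<t)) (X^-< n<t)

sumTo-X^-≤ : ∀ n t (h : ℕ → ℤ) → t ℕ.≤ n → sumTo n (λ i → (X^ t) i ℤ.* h i) ≡ h t
sumTo-X^-≤ zero    .zero h z≤n = trans (cong (ℤ._* h 0) (X^-self 0)) (ℤP.*-identityˡ (h 0))
sumTo-X^-≤ (suc n) t    h t≤1+n with ℕP.m≤n⇒m<n∨m≡n t≤1+n
... | inj₁ t<1+n = begin
  sumTo n (λ i → (X^ t) i ℤ.* h i) + (X^ t) (suc n) ℤ.* h (suc n)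
    ≡⟨ cong₂ (λ s x → s + x ℤ.* h (suc n)) (sumTo-X^-≤ n t h (ℕP.≤-pred t<1+n)) (X^-≢ (ℕP.>⇒≢ t<1+n)) ⟩
  h t + + 0                                 ≡⟨ ℤP.+-identityʳ (h t) ⟩
  h t ∎
... | inj₂ refl = begin
  sumTo n (λ i → (X^ t) i ℤ.* h i) + (X^ t) t ℤ.* h t
    ≡⟨ cong₂ (λ s x → s + x ℤ.* h t) (sumTo-X^-< n t h ℕP.≤-refl) (X^-self t) ⟩
  + 0 + + 1 ℤ.* h t                         ≡⟨ ℤP.+-identityˡ (+ 1 ℤ.* h t) ⟩
  + 1 ℤ.* h t                               ≡⟨ ℤP.*-identityˡ (h t) ⟩
  h t ∎

X^-⊛-< : ∀ {t n} H → n ℕ.< t → (X^ t ⊛ H) n ≡ + 0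
X^-⊛-< {t} {n} H = sumTo-X^-< n t (λ i → H (n ℕ.∸ i))

X^-⊛-≤ : ∀ {t n} H → t ℕ.≤ n → (X^ t ⊛ H) n ≡ H (n ℕ.∸ t)
X^-⊛-≤ {t} {n} H = sumTo-X^-≤ n t (λ i → H (n ℕ.∸ i))

⊛-cong : ∀ {f f′ g g′} → f ≗ f′ → g ≗ g′ → f ⊛ g ≗ f′ ⊛ g′
⊛-cong f≗f′ g≗g′ n = sumTo-cong n (λ i _ → cong₂ ℤ._*_ (f≗f′ i) (g≗g′ (n ℕ.∸ i)))

⊛-congˡ : ∀ f {g g′} → g ≗ g′ → f ⊛ g ≗ f ⊛ g′
⊛-congˡ f = ⊛-cong {f} {f} (λ _ → refl)

⊛-congʳ : ∀ {f f′} g → f ≗ f′ → f ⊛ g ≗ f′ ⊛ g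
⊛-congʳ {f} {f′} g f≗f′ = ⊛-cong {f} {f′} {g} {g} f≗f′ (λ _ → refl)

⊛-comm : ∀ f g → f ⊛ g ≗ g ⊛ f
⊛-comm f g n = trans (sumTo-reverse n _) (sumTo-cong n swap)
  where
  swap : ∀ i → i ℕ.≤ n → f (n ℕ.∸ i) ℤ.* g (n ℕ.∸ (n ℕ.∸ i)) ≡ g i ℤ.* f (n ℕ.∸ i)
  swap i i≤n = trans (cong (λ j → f (n ℕ.∸ i) ℤ.* g j) (ℕP.m∸[m∸n]≡n i≤n)) (ℤP.*-comm (f (n ℕ.∸ i)) (g i))

⊛-identityˡ : ∀ f → onePS ⊛ f ≗ f
⊛-identityˡ f n = trans (⊛-congʳ f onePS≗X^0 n) (X^-⊛-≤ f z≤n)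

⊛-identityʳ : ∀ f → f ⊛ onePS ≗ f
⊛-identityʳ f n = trans (⊛-comm f onePS n) (⊛-identityˡ f n)

⊛-distribʳ : ∀ f g h → (f ⊕ g) ⊛ h ≗ f ⊛ h ⊕ g ⊛ h
⊛-distribʳ f g h n =
  trans (sumTo-cong n (λ i _ → ℤP.*-distribʳ-+ (h (n ℕ.∸ i)) (f i) (g i))) (sumTo-+ n _ _)

·-⊛ : ∀ c f g → (c · f) ⊛ g ≗ c · (f ⊛ g)
·-⊛ c f g n = trans (sumTo-cong n (λ i _ → ℤP.*-assoc c (f i) (g (n ℕ.∸ i)))) (sumTo-*ˡ n c _)

tail : PS → PS
tail f n = f (suc n)

⊛-suc : ∀ f g n → (f ⊛ g) (suc n) ≡ f 0 ℤ.* g (suc n) + (tail f ⊛ g) n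
⊛-suc f g n = sumTo-suc n _

tail-⊛ : ∀ f g → tail (f ⊛ g) ≗ f 0 · tail g ⊕ tail f ⊛ g
tail-⊛ = ⊛-suc

⊛-assoc : ∀ f g h → (f ⊛ g) ⊛ h ≗ f ⊛ (g ⊛ h)
⊛-assoc f g h zero    = ℤP.*-assoc (f 0) (g 0) (h 0)
⊛-assoc f g h (suc n) = begin
  ((f ⊛ g) ⊛ h) (suc n)
    ≡⟨ ⊛-suc (f ⊛ g) h n ⟩
  (f 0 ℤ.* g 0) ℤ.* h (suc n) + (tail (f ⊛ g) ⊛ h) n
    ≡⟨ cong (_+_ lead) (⊛-congʳ h (tail-⊛ f g) n) ⟩
  (f 0 ℤ.* g 0) ℤ.* h (suc n) + ((f 0 · tail g ⊕ tail f ⊛ g) ⊛ h) n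
    ≡⟨ cong (_+_ lead) (⊛-distribʳ (f 0 · tail g) (tail f ⊛ g) h n) ⟩
  (f 0 ℤ.* g 0) ℤ.* h (suc n) + (((f 0 · tail g) ⊛ h) n + ((tail f ⊛ g) ⊛ h) n)
    ≡⟨ cong (_+_ lead) (cong₂ _+_ (·-⊛ (f 0) (tail g) h n) (⊛-assoc (tail f) g h n)) ⟩
  (f 0 ℤ.* g 0) ℤ.* h (suc n) + (f 0 ℤ.* (tail g ⊛ h) n + (tail f ⊛ (g ⊛ h)) n)
    ≡⟨ regroup (f 0) (g 0) (h (suc n)) _ _ ⟩
  f 0 ℤ.* (g 0 ℤ.* h (suc n) + (tail g ⊛ h) n) + (tail f ⊛ (g ⊛ h)) n
    ≡⟨ cong (λ x → f 0 ℤ.* x + (tail f ⊛ (g ⊛ h)) n) (sym (⊛-suc g h n)) ⟩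
  f 0 ℤ.* (g ⊛ h) (suc n) + (tail f ⊛ (g ⊛ h)) n
    ≡⟨ sym (⊛-suc f (g ⊛ h) n) ⟩
  (f ⊛ (g ⊛ h)) (suc n) ∎
  where
  lead : ℤ
  lead = (f 0 ℤ.* g 0) ℤ.* h (suc n)
  regroup : ∀ x y z u v → (x ℤ.* y) ℤ.* z + (x ℤ.* u + v) ≡ x ℤ.* (y ℤ.* z + u) + v
  regroup = solve-∀

⊛-interchange : ∀ f g h k → (f ⊛ g) ⊛ (h ⊛ k) ≗ (f ⊛ h) ⊛ (g ⊛ k)
⊛-interchange f g h k n = begin
  ((f ⊛ g) ⊛ (h ⊛ k)) n ≡⟨ ⊛-assoc f g (h ⊛ k) n ⟩
  (f ⊛ (g ⊛ (h ⊛ k))) n ≡⟨ ⊛-congˡ f (λ i → sym (⊛-assoc g h k i)) n ⟩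
  (f ⊛ ((g ⊛ h) ⊛ k)) n ≡⟨ ⊛-congˡ f (⊛-congʳ k (⊛-comm g h)) n ⟩
  (f ⊛ ((h ⊛ g) ⊛ k)) n ≡⟨ ⊛-congˡ f (⊛-assoc h g k) n ⟩
  (f ⊛ (h ⊛ (g ⊛ k))) n ≡⟨ sym (⊛-assoc f h (g ⊛ k) n) ⟩
  ((f ⊛ h) ⊛ (g ⊛ k)) n ∎

-- Binomials 1 + c X^m

AgreeBelow : ℕ → PS → PS → Set
AgreeBelow N f g = ∀ n → n ℕ.< N → f n ≡ g n

⊛-cong-below : ∀ {N f f′ g g′} → AgreeBelow N f f′ → AgreeBelow N g g′ → AgreeBelow N (f ⊛ g) (f′ ⊛ g′)
⊛-cong-below f≈f′ g≈g′ n n<N = sumTo-cong n λ i i≤n →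
  cong₂ ℤ._*_ (f≈f′ i (ℕP.≤-<-trans i≤n n<N)) (g≈g′ (n ℕ.∸ i) (ℕP.≤-<-trans (ℕP.m∸n≤m n i) n<N))

binomial : ℕ → ℤ → PS
binomial m c = onePS ⊕ c · X^ m

binomial-⊛ : ∀ m c H → binomial m c ⊛ H ≗ H ⊕ c · (X^ m ⊛ H)
binomial-⊛ m c H n =
  trans (⊛-distribʳ onePS (c · X^ m) H n) (cong₂ _+_ (⊛-identityˡ H n) (·-⊛ c (X^ m) H n))

X^0-∸ : ∀ {t n} → t ℕ.≤ n → (X^ 0) (n ℕ.∸ t) ≡ (X^ t) n
X^0-∸ {t} {n} t≤n with ℕP.m≤n⇒m<n∨m≡n t≤n
... | inj₁ t<n  = trans (X^-≢ (λ n∸t≡0 → ℕP.<⇒≱ t<n (ℕP.m∸n≡0⇒m≤n n∸t≡0))) (sym (X^-≢ (ℕP.>⇒≢ t<n)))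
... | inj₂ refl = trans (cong (X^ 0) (ℕP.n∸n≡0 t)) (trans (X^-self 0) (sym (X^-self t)))

X^-⊛-binomial : ∀ m d {n} → n ℕ.< m ℕ.+ m → (X^ m ⊛ binomial m d) n ≡ (X^ m) n
X^-⊛-binomial m d {n} n<2m with m ℕ.≤? n
... | no  m≰n = trans (X^-⊛-< (binomial m d) (ℕP.≰⇒> m≰n)) (sym (X^-< (ℕP.≰⇒> m≰n)))
... | yes m≤n = begin
  (X^ m ⊛ binomial m d) n                            ≡⟨ X^-⊛-≤ (binomial m d) m≤n ⟩
  onePS (n ℕ.∸ m) + d ℤ.* (X^ m) (n ℕ.∸ m)           ≡⟨ cong₂ (λ x y → x + d ℤ.* y) (trans (onePS≗X^0 _) (X^0-∸ m≤n)) (X^-< n∸m<m) ⟩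
  (X^ m) n + d ℤ.* + 0                               ≡⟨ cong (_+_ ((X^ m) n)) (ℤP.*-zeroʳ d) ⟩
  (X^ m) n + + 0                                     ≡⟨ ℤP.+-identityʳ _ ⟩
  (X^ m) n ∎
  where
  n∸m<m : n ℕ.∸ m ℕ.< m
  n∸m<m = subst (n ℕ.∸ m ℕ.<_) (ℕP.m+n∸m≡n m m) (ℕP.∸-monoˡ-< n<2m m≤n)

binomial-⊛-binomial : ∀ m c d {n} → n ℕ.< m ℕ.+ m → (binomial m c ⊛ binomial m d) n ≡ binomial m (c + d) n
binomial-⊛-binomial m c d {n} n<2m = begin
  (binomial m c ⊛ binomial m d) n                    ≡⟨ binomial-⊛ m c (binomial m d) n ⟩
  binomial m d n + c ℤ.* (X^ m ⊛ binomial m d) n     ≡⟨ cong (λ x → binomial m d n + c ℤ.* x) (X^-⊛-binomial m d n<2m) ⟩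
  (onePS n + d ℤ.* (X^ m) n) + c ℤ.* (X^ m) n        ≡⟨ collect (onePS n) ((X^ m) n) c d ⟩
  binomial m (c + d) n ∎
  where
  collect : ∀ x y c d → (x + d ℤ.* y) + c ℤ.* y ≡ x + (c + d) ℤ.* y
  collect = solve-∀

powPS-binomial : ∀ {m G} g → AgreeBelow (m ℕ.+ m) G (binomial m g) →
  ∀ j → AgreeBelow (m ℕ.+ m) (powPS G j) (binomial m (+ j ℤ.* g))
powPS-binomial {m} g G≈ zero    n _    =
  trans (sym (ℤP.+-identityʳ (onePS n))) (cong (_+_ (onePS n)) (sym (ℤP.*-zeroˡ ((X^ m) n))))
powPS-binomial {m} {G} g G≈ (suc j) n n<2m = begin
  (G ⊛ powPS G j) n                           ≡⟨ ⊛-cong-below G≈ (powPS-binomial g G≈ j) n n<2m ⟩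
  (binomial m g ⊛ binomial m (+ j ℤ.* g)) n   ≡⟨ binomial-⊛-binomial m g (+ j ℤ.* g) n<2m ⟩
  binomial m (g + + j ℤ.* g) n                ≡⟨ cong (λ c → binomial m c n) (count g (+ j)) ⟩
  binomial m (+ suc j ℤ.* g) n ∎
  where
  count : ∀ g x → g + x ℤ.* g ≡ (+ 1 + x) ℤ.* g
  count = solve-∀

∣∧<double⇒≡0∨≡ : ∀ {m n} → m ∣ n → n ℕ.< m ℕ.+ m → n ≡ 0 ⊎ n ≡ m
∣∧<double⇒≡0∨≡ (divides zero          n≡0)   _    = inj₁ n≡0
∣∧<double⇒≡0∨≡ (divides (suc zero)    n≡m+0) _    = inj₂ (trans n≡m+0 (ℕP.+-identityʳ _))
∣∧<double⇒≡0∨≡ {m} (divides (suc (suc q)) refl) n<2m =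
  ⊥-elim (ℕP.<⇒≱ n<2m (ℕP.+-monoʳ-≤ m (ℕP.m≤m+n m (q * m))))

geo-binomial : ∀ {m} → 1 ℕ.≤ m → AgreeBelow (m ℕ.+ m) (geo m) (binomial m (+ 1))
geo-binomial {m} 1≤m n n<2m with m ∣? n
... | no m∤n = sym (cong₂ (λ x y → x + + 1 ℤ.* y)
                          (trans (onePS≗X^0 n) (X^-≢ (λ { refl → m∤n (divides 0 refl) })))
                          (X^-≢ (λ { refl → m∤n (divides 1 (sym (ℕP.+-identityʳ n))) })))
... | yes m∣n with ∣∧<double⇒≡0∨≡ m∣n n<2m
...   | inj₁ refl = sym (cong (_+_ (+ 1)) (trans (ℤP.*-identityˡ _) (X^-< 1≤m)))
...   | inj₂ refl = sym (cong₂ (λ x y → x + + 1 ℤ.* y) (trans (onePS≗X^0 m) (X^-≢ (ℕP.>⇒≢ 1≤m))) (X^-self m))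

oneMinus≗binomial : ∀ {m} → 1 ℕ.≤ m → oneMinus m ≗ binomial m -[1+ 0 ]
oneMinus≗binomial 1≤m zero = sym (cong (_+_ (+ 1)) (cong (ℤ._*_ -[1+ 0 ]) (X^-< 1≤m)))
oneMinus≗binomial {m} _ (suc n) with suc n ℕ.≟ m
... | yes _ = refl
... | no  _ = refl

factor-binomial : ∀ {m} c → 1 ℕ.≤ m → AgreeBelow (m ℕ.+ m) (factor m c) (binomial m c)
factor-binomial {m} (+ j) 1≤m n n<2m =
  trans (powPS-binomial (+ 1) (geo-binomial 1≤m) j n n<2m)
        (cong (λ c → binomial m c n) (ℤP.*-identityʳ (+ j)))
factor-binomial {m} -[1+ j ] 1≤m n n<2m =
  trans (powPS-binomial -[1+ 0 ] (λ i _ → oneMinus≗binomial 1≤m i) (suc j) n n<2m)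
        (cong (λ c → binomial m c n) (trans (ℤP.*-comm (+ suc j) -[1+ 0 ]) (ℤP.-1*i≡-i (+ suc j))))

prodFactors-suc : ∀ a m {n} → n ℕ.< suc m ℕ.+ suc m →
  prodFactors a (suc m) n ≡ prodFactors a m n + a (suc m) ℤ.* (X^ (suc m) ⊛ prodFactors a m) n
prodFactors-suc a m {n} n<2m = begin
  (prodFactors a m ⊛ factor (suc m) (a (suc m))) n  ≡⟨ ⊛-comm (prodFactors a m) (factor (suc m) (a (suc m))) n ⟩
  (factor (suc m) (a (suc m)) ⊛ prodFactors a m) n  ≡⟨ ⊛-cong-below {g = prodFactors a m} (factor-binomial (a (suc m)) (s≤s z≤n))
                                                                     (λ _ _ → refl) n n<2m ⟩
  (binomial (suc m) (a (suc m)) ⊛ prodFactors a m) n ≡⟨ binomial-⊛ (suc m) (a (suc m)) (prodFactors a m) n ⟩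
  prodFactors a m n + a (suc m) ℤ.* (X^ (suc m) ⊛ prodFactors a m) n ∎

oneMinus-⊛-< : ∀ {t n} H → 1 ℕ.≤ t → n ℕ.< t → (oneMinus t ⊛ H) n ≡ H n
oneMinus-⊛-< {t} {n} H 1≤t n<t = begin
  (oneMinus t ⊛ H) n                          ≡⟨ ⊛-congʳ H (oneMinus≗binomial 1≤t) n ⟩
  (binomial t -[1+ 0 ] ⊛ H) n                 ≡⟨ binomial-⊛ t -[1+ 0 ] H n ⟩
  H n + -[1+ 0 ] ℤ.* (X^ t ⊛ H) n             ≡⟨ cong (λ x → H n + -[1+ 0 ] ℤ.* x) (X^-⊛-< H n<t) ⟩
  H n + + 0                                   ≡⟨ ℤP.+-identityʳ (H n) ⟩
  H n ∎

oneMinus-⊛-≤ : ∀ {t n} H → 1 ℕ.≤ t → t ℕ.≤ n → (oneMinus t ⊛ H) n ≡ H n - H (n ℕ.∸ t)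
oneMinus-⊛-≤ {t} {n} H 1≤t t≤n = begin
  (oneMinus t ⊛ H) n                          ≡⟨ ⊛-congʳ H (oneMinus≗binomial 1≤t) n ⟩
  (binomial t -[1+ 0 ] ⊛ H) n                 ≡⟨ binomial-⊛ t -[1+ 0 ] H n ⟩
  H n + -[1+ 0 ] ℤ.* (X^ t ⊛ H) n             ≡⟨ cong (λ x → H n + -[1+ 0 ] ℤ.* x) (X^-⊛-≤ H t≤n) ⟩
  H n + -[1+ 0 ] ℤ.* H (n ℕ.∸ t)              ≡⟨ cong (_+_ (H n)) (ℤP.-1*i≡-i (H (n ℕ.∸ t))) ⟩
  H n - H (n ℕ.∸ t) ∎

oneMinus-⊛-ones-< : ∀ {t H} → 1 ℕ.≤ t → (∀ n → H n ≡ + 1) → ∀ {i} → i ℕ.< t → (oneMinus t ⊛ H) i ≡ + 1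
oneMinus-⊛-ones-< {H = H} 1≤t H≡1 i<t = trans (oneMinus-⊛-< H 1≤t i<t) (H≡1 _)

oneMinus-⊛-ones-≥ : ∀ {t H} → 1 ℕ.≤ t → (∀ n → H n ≡ + 1) → ∀ {i} → t ℕ.≤ i → (oneMinus t ⊛ H) i ≡ + 0
oneMinus-⊛-ones-≥ {H = H} 1≤t H≡1 t≤i = trans (oneMinus-⊛-≤ H 1≤t t≤i) (cong₂ _-_ (H≡1 _) (H≡1 _))

geo-1 : ∀ n → geo 1 n ≡ + 1
geo-1 n with 1 ∣? n
... | yes _  = refl
... | no 1∤n = ⊥-elim (1∤n (1∣ n))

-- Inverses and polynomial growth

geo-periodic : ∀ {j n} → j ℕ.≤ n → geo j n ≡ geo j (n ℕ.∸ j)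
geo-periodic {j} {n} j≤n with j ∣? n | j ∣? (n ℕ.∸ j)
... | yes _   | yes _   = refl
... | no  _   | no  _   = refl
... | yes j∣n | no  j∤n∸j = ⊥-elim (j∤n∸j (∣m+n∣m⇒∣n (subst (j ∣_) (sym (ℕP.m+[n∸m]≡n j≤n)) j∣n) ∣-refl))
... | no  j∤n | yes j∣n∸j = ⊥-elim (j∤n (∣m∸n∣n⇒∣m j j≤n j∣n∸j ∣-refl))

oneMinus-⊛-geo : ∀ {j} → 1 ℕ.≤ j → oneMinus j ⊛ geo j ≗ onePS
oneMinus-⊛-geo {j} 1≤j n with j ℕ.≤? n
... | yes j≤n = begin
  (oneMinus j ⊛ geo j) n       ≡⟨ oneMinus-⊛-≤ (geo j) 1≤j j≤n ⟩
  geo j n - geo j (n ℕ.∸ j)    ≡⟨ cong (_- geo j (n ℕ.∸ j)) (geo-periodic j≤n) ⟩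
  geo j (n ℕ.∸ j) - geo j (n ℕ.∸ j) ≡⟨ ℤP.+-inverseʳ (geo j (n ℕ.∸ j)) ⟩
  + 0                          ≡⟨ sym (trans (onePS≗X^0 n) (X^-≢ (ℕP.>⇒≢ (ℕP.≤-trans 1≤j j≤n)))) ⟩
  onePS n ∎
... | no j≰n = begin
  (oneMinus j ⊛ geo j) n       ≡⟨ oneMinus-⊛-< (geo j) 1≤j n<j ⟩
  geo j n                      ≡⟨ geo-binomial 1≤j n (ℕP.<-≤-trans n<j (ℕP.m≤m+n j j)) ⟩
  onePS n + + 1 ℤ.* (X^ j) n   ≡⟨ cong (λ x → onePS n + + 1 ℤ.* x) (X^-< n<j) ⟩
  onePS n + + 0                ≡⟨ ℤP.+-identityʳ (onePS n) ⟩
  onePS n ∎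
  where
  n<j : n ℕ.< j
  n<j = ℕP.≰⇒> j≰n

⊛-inverse-⊛ : ∀ {f f′ g g′} → f ⊛ f′ ≗ onePS → g ⊛ g′ ≗ onePS → (f ⊛ g) ⊛ (f′ ⊛ g′) ≗ onePS
⊛-inverse-⊛ {f} {f′} {g} {g′} ff′≗1 gg′≗1 n = begin
  ((f ⊛ g) ⊛ (f′ ⊛ g′)) n      ≡⟨ ⊛-interchange f g f′ g′ n ⟩
  ((f ⊛ f′) ⊛ (g ⊛ g′)) n      ≡⟨ ⊛-cong ff′≗1 gg′≗1 n ⟩
  (onePS ⊛ onePS) n            ≡⟨ ⊛-identityˡ onePS n ⟩
  onePS n ∎

powPS-inverse : ∀ {f g} → f ⊛ g ≗ onePS → ∀ m → powPS f m ⊛ powPS g m ≗ onePS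
powPS-inverse         fg≗1 zero    = ⊛-identityˡ onePS
powPS-inverse {f} {g} fg≗1 (suc m) = ⊛-inverse-⊛ {f} {g} {powPS f m} {powPS g m} fg≗1 (powPS-inverse fg≗1 m)

invFactor : ℕ → ℤ → PS
invFactor j (+ m)    = powPS (oneMinus j) m
invFactor j -[1+ m ] = powPS (geo j) (suc m)

factor-⊛-invFactor : ∀ {j} → 1 ℕ.≤ j → ∀ c → factor j c ⊛ invFactor j c ≗ onePS
factor-⊛-invFactor {j} 1≤j (+ m)    =
  powPS-inverse {geo j} {oneMinus j} (λ n → trans (⊛-comm (geo j) (oneMinus j) n) (oneMinus-⊛-geo 1≤j n)) m
factor-⊛-invFactor {j} 1≤j -[1+ m ] = powPS-inverse {oneMinus j} {geo j} (oneMinus-⊛-geo 1≤j) (suc m)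

prodInverse : (ℕ → ℤ) → ℕ → PS
prodInverse a zero    = onePS
prodInverse a (suc L) = prodInverse a L ⊛ invFactor (suc L) (a (suc L))

prodFactors-⊛-prodInverse : ∀ a L → prodFactors a L ⊛ prodInverse a L ≗ onePS
prodFactors-⊛-prodInverse a zero    = ⊛-identityˡ onePS
prodFactors-⊛-prodInverse a (suc L) =
  ⊛-inverse-⊛ {prodFactors a L} {prodInverse a L} {factor (suc L) (a (suc L))} {invFactor (suc L) (a (suc L))}
              (prodFactors-⊛-prodInverse a L) (factor-⊛-invFactor (s≤s z≤n) (a (suc L)))

⊛-solveˡ : ∀ {f g t s} → f ⊛ g ≗ onePS → f ⊛ t ≗ s → t ≗ g ⊛ s
⊛-solveˡ {f} {g} {t} {s} fg≗1 ft≗s n = begin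
  t n                          ≡⟨ sym (⊛-identityˡ t n) ⟩
  (onePS ⊛ t) n                ≡⟨ ⊛-congʳ t (λ i → sym (trans (⊛-comm g f i) (fg≗1 i))) n ⟩
  ((g ⊛ f) ⊛ t) n              ≡⟨ ⊛-assoc g f t n ⟩
  (g ⊛ (f ⊛ t)) n              ≡⟨ ⊛-congˡ g ft≗s n ⟩
  (g ⊛ s) n ∎

PolyBoundedBy : ℕ → PS → Set
PolyBoundedBy D f = ∀ n → ∣ f n ∣ ℕ.≤ (D * suc n) ^ D

PolyBounded : PS → Set
PolyBounded f = ∃[ D ] PolyBoundedBy D f

∣sumTo∣≤ : ∀ n (h : ℕ → ℤ) M → (∀ i → i ℕ.≤ n → ∣ h i ∣ ℕ.≤ M) → ∣ sumTo n h ∣ ℕ.≤ suc n * M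
∣sumTo∣≤ zero    h M h≤M = subst (∣ h 0 ∣ ℕ.≤_) (sym (ℕP.*-identityˡ M)) (h≤M 0 z≤n)
∣sumTo∣≤ (suc n) h M h≤M =
  ℕP.≤-trans (ℤP.∣i+j∣≤∣i∣+∣j∣ (sumTo n h) (h (suc n)))
    (ℕP.≤-trans (ℕP.+-mono-≤ (∣sumTo∣≤ n h M (λ i i≤n → h≤M i (ℕP.m≤n⇒m≤1+n i≤n))) (h≤M (suc n) ℕP.≤-refl))
      (ℕP.≤-reflexive (ℕP.+-comm (suc n * M) M)))

PolyBoundedBy-⊛ : ∀ {D D′} f g → PolyBoundedBy D f → PolyBoundedBy D′ g → PolyBoundedBy (suc (D ℕ.+ D′)) (f ⊛ g)
PolyBoundedBy-⊛ {D} {D′} f g f≤ g≤ n =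
  ℕP.≤-trans (∣sumTo∣≤ n _ _ term≤)
    (ℕP.≤-trans (ℕP.*-mono-≤ (ℕP.m≤n*m (suc n) E) (ℕP.*-mono-≤ (^-base D D≤E) (^-base D′ D′≤E)))
      (ℕP.≤-reflexive (cong (X *_) (sym (ℕP.^-distribˡ-+-* X D D′)))))
  where
  E X : ℕ
  E = suc (D ℕ.+ D′)
  X = E * suc n
  D≤E : D ℕ.≤ E
  D≤E = ℕP.m≤n⇒m≤1+n (ℕP.m≤m+n D D′)
  D′≤E : D′ ℕ.≤ E
  D′≤E = ℕP.m≤n⇒m≤1+n (ℕP.m≤n+m D′ D)
  ^-base : ∀ e {d} → d ℕ.≤ E → (d * suc n) ^ e ℕ.≤ X ^ e
  ^-base e d≤E = ℕP.^-monoˡ-≤ e (ℕP.*-monoˡ-≤ (suc n) d≤E)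
  term≤ : ∀ i → i ℕ.≤ n → ∣ f i ℤ.* g (n ℕ.∸ i) ∣ ℕ.≤ (D * suc n) ^ D * (D′ * suc n) ^ D′
  term≤ i i≤n = ℕP.≤-trans (ℕP.≤-reflexive (ℤP.abs-* (f i) (g (n ℕ.∸ i))))
    (ℕP.*-mono-≤ (ℕP.≤-trans (f≤ i) (ℕP.^-monoˡ-≤ D (ℕP.*-monoʳ-≤ D (s≤s i≤n))))
                 (ℕP.≤-trans (g≤ (n ℕ.∸ i)) (ℕP.^-monoˡ-≤ D′ (ℕP.*-monoʳ-≤ D′ (s≤s (ℕP.m∸n≤m n i))))))

PolyBounded-⊛ : ∀ f g → PolyBounded f → PolyBounded g → PolyBounded (f ⊛ g)
PolyBounded-⊛ f g (D , f≤) (D′ , g≤) = suc (D ℕ.+ D′) , PolyBoundedBy-⊛ {D} {D′} f g f≤ g≤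

PolyBounded-unit : ∀ f → (∀ n → ∣ f n ∣ ℕ.≤ 1) → PolyBounded f
PolyBounded-unit f f≤1 = 1 , λ n → ℕP.≤-trans (f≤1 n) (s≤s z≤n)

PolyBounded-onePS : PolyBounded onePS
PolyBounded-onePS = PolyBounded-unit onePS λ { zero → ℕP.≤-refl ; (suc n) → z≤n }

PolyBounded-powPS : ∀ f → PolyBounded f → ∀ m → PolyBounded (powPS f m)
PolyBounded-powPS f f-bd zero    = PolyBounded-onePS
PolyBounded-powPS f f-bd (suc m) = PolyBounded-⊛ f (powPS f m) f-bd (PolyBounded-powPS f f-bd m)

PolyBounded-invFactor : ∀ j c → PolyBounded (invFactor j c)
PolyBounded-invFactor j (+ m)    = PolyBounded-powPS (oneMinus j) (PolyBounded-unit (oneMinus j) oneMinus≤1) m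
  where
  oneMinus≤1 : ∀ n → ∣ oneMinus j n ∣ ℕ.≤ 1
  oneMinus≤1 zero = ℕP.≤-refl
  oneMinus≤1 (suc n) with suc n ℕ.≟ j
  ... | yes _ = ℕP.≤-refl
  ... | no  _ = z≤n
PolyBounded-invFactor j -[1+ m ] = PolyBounded-powPS (geo j) (PolyBounded-unit (geo j) geo≤1) (suc m)
  where
  geo≤1 : ∀ n → ∣ geo j n ∣ ℕ.≤ 1
  geo≤1 n with j ∣? n
  ... | yes _ = ℕP.≤-refl
  ... | no  _ = z≤n

PolyBounded-prodInverse : ∀ a L → PolyBounded (prodInverse a L)
PolyBounded-prodInverse a zero    = PolyBounded-onePS
PolyBounded-prodInverse a (suc L) = PolyBounded-⊛ (prodInverse a L) (invFactor (suc L) (a (suc L)))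
  (PolyBounded-prodInverse a L) (PolyBounded-invFactor (suc L) (a (suc L)))

PolyBounded-seriesOf : ∀ {ε} → IsSignSeq ε → PolyBounded (seriesOf ε)
PolyBounded-seriesOf {ε} signs = PolyBounded-unit (seriesOf ε) ε≤1
  where
  ε≤1 : ∀ n → ∣ seriesOf ε n ∣ ℕ.≤ 1
  ε≤1 zero = ℕP.≤-refl
  ε≤1 (suc n) with signs (suc n) (s≤s z≤n)
  ... | inj₁ ε≡-1        = ℕP.≤-reflexive (cong ∣_∣ ε≡-1)
  ... | inj₂ (inj₁ ε≡0) = ℕP.≤-trans (ℕP.≤-reflexive (cong ∣_∣ ε≡0)) z≤n
  ... | inj₂ (inj₂ ε≡1) = ℕP.≤-reflexive (cong ∣_∣ ε≡1)

tailSeries-above : ∀ L η {j} → L ℕ.< suc j → tailSeries L η (suc j) ≡ η (suc j)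
tailSeries-above L η {j} L<1+j with suc j ℕ.≤? L
... | yes 1+j≤L = ⊥-elim (ℕP.<⇒≱ L<1+j 1+j≤L)
... | no  _     = refl

tail-coefficients-bounded : ∀ {ε} a L η → IsSignSeq ε → IsTailFactorization ε a L η →
  ∃[ A ] ∃[ B ] (1 ℕ.≤ A × 1 ℕ.≤ B × (∀ j → L ℕ.< j → ∣ η j ∣ ℕ.≤ (A * j) ^ B))
tail-coefficients-bounded {ε} a L η signs factorization
  with PolyBounded-prodInverse a L | PolyBounded-seriesOf signs
... | D , inverse≤ | D′ , series≤ = E ℕ.+ E , E , s≤s z≤n , s≤s z≤n , η≤
  where
  E : ℕ
  E = suc (D ℕ.+ D′)
  tail≗ : tailSeries L η ≗ prodInverse a L ⊛ seriesOf ε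
  tail≗ = ⊛-solveˡ {prodFactors a L} {prodInverse a L} (prodFactors-⊛-prodInverse a L) factorization
  η≤ : ∀ j → L ℕ.< j → ∣ η j ∣ ℕ.≤ ((E ℕ.+ E) * j) ^ E
  η≤ (suc j) L<1+j =
    ℕP.≤-trans (ℕP.≤-reflexive (cong ∣_∣ (trans (sym (tailSeries-above L η L<1+j)) (tail≗ (suc j)))))
      (ℕP.≤-trans (PolyBoundedBy-⊛ {D} {D′} (prodInverse a L) (seriesOf ε) inverse≤ series≤ (suc j))
        (ℕP.^-monoˡ-≤ E (subst₂ ℕ._≤_ (sym (ℕP.*-suc E (suc j))) (sym (ℕP.*-distribʳ-+ (suc j) E E))
                                      (ℕP.+-monoˡ-≤ (E * suc j) (ℕP.m≤m*n E (suc j))))))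

-- The exponent recurrence

module ExponentSequence (ε a : ℕ → ℤ) (ex : IsExponentSeq ε a) where

  P : ℕ → PS
  P = prodFactors a

  exponent-recurrence : ∀ m → a (suc m) ≡ ε (suc m) - P m (suc m)
  exponent-recurrence m = begin
    a (suc m)                                             ≡⟨ isolate (P m (suc m)) (a (suc m)) ⟩
    (P m (suc m) + a (suc m) ℤ.* + 1) - P m (suc m)       ≡⟨ cong (_- P m (suc m)) top-coefficient ⟩
    ε (suc m) - P m (suc m) ∎
    where
    isolate : ∀ x y → y ≡ (x + y ℤ.* + 1) - x
    isolate = solve-∀
    X^-⊛-P-diagonal : (X^ (suc m) ⊛ P m) (suc m) ≡ + 1
    X^-⊛-P-diagonal = trans (X^-⊛-≤ {suc m} {suc m} (P m) ℕP.≤-refl) (trans (cong (P m) (ℕP.n∸n≡0 m)) (ex m 0 z≤n))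
    top-coefficient : P m (suc m) + a (suc m) ℤ.* + 1 ≡ ε (suc m)
    top-coefficient = begin
      P m (suc m) + a (suc m) ℤ.* + 1                       ≡⟨ cong (λ x → P m (suc m) + a (suc m) ℤ.* x) (sym X^-⊛-P-diagonal) ⟩
      P m (suc m) + a (suc m) ℤ.* (X^ (suc m) ⊛ P m) (suc m) ≡⟨ sym (prodFactors-suc a m (s≤s (ℕP.m≤n+m (suc m) m))) ⟩
      P (suc m) (suc m)                                     ≡⟨ ex (suc m) (suc m) ℕP.≤-refl ⟩
      ε (suc m) ∎

  a-1 : ε 1 ≡ + 1 → a 1 ≡ + 1
  a-1 ε₁≡1 = trans (exponent-recurrence 0) (cong (_- + 0) ε₁≡1)

  a-vanishes : ∀ m → (∀ n → P m n ≡ + 1) → ε (suc m) ≡ + 1 → a (suc m) ≡ + 0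
  a-vanishes m P≡1 ε≡1 = trans (exponent-recurrence m) (cong₂ _-_ ε≡1 (P≡1 (suc m)))

  module _ (k : ℕ) (ε≡1 : ∀ j → 1 ℕ.≤ j → j ℕ.< k → ε j ≡ + 1) where

    P-ones : ∀ m → suc m ℕ.< k → ∀ n → P (suc m) n ≡ + 1
    P-ones zero 1<k n = begin
      (onePS ⊛ factor 1 (a 1)) n  ≡⟨ ⊛-identityˡ (factor 1 (a 1)) n ⟩
      factor 1 (a 1) n            ≡⟨ cong (λ c → factor 1 c n) (a-1 (ε≡1 1 ℕP.≤-refl 1<k)) ⟩
      (geo 1 ⊛ onePS) n           ≡⟨ ⊛-identityʳ (geo 1) n ⟩
      geo 1 n                     ≡⟨ geo-1 n ⟩
      + 1 ∎
    P-ones (suc m) 2+m<k n = begin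
      (P (suc m) ⊛ factor (suc (suc m)) (a (suc (suc m)))) n ≡⟨ cong (λ c → (P (suc m) ⊛ factor (suc (suc m)) c) n) a≡0 ⟩
      (P (suc m) ⊛ onePS) n                                  ≡⟨ ⊛-identityʳ (P (suc m)) n ⟩
      P (suc m) n                                            ≡⟨ P-ones m 1+m<k n ⟩
      + 1 ∎
      where
      1+m<k : suc m ℕ.< k
      1+m<k = ℕP.<-trans (ℕP.n<1+n (suc m)) 2+m<k
      a≡0 : a (suc (suc m)) ≡ + 0
      a≡0 = a-vanishes (suc m) (P-ones m 1+m<k) (ε≡1 (suc (suc m)) (s≤s z≤n) 2+m<k)

    a-below : ∀ j → 2 ℕ.≤ j → j ℕ.< k → a j ≡ + 0
    a-below (suc zero)    (s≤s ()) _
    a-below (suc (suc m)) _ 2+m<k =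
      a-vanishes (suc m) (P-ones m (ℕP.<-trans (ℕP.n<1+n (suc m)) 2+m<k)) (ε≡1 (suc (suc m)) (s≤s z≤n) 2+m<k)

  a-first-non-one : ∀ m → (∀ n → P m n ≡ + 1) → ε (suc m) ≡ + 0 ⊎ ε (suc m) ≡ -[1+ 0 ] →
    a (suc m) ≡ -[1+ ∣ ε (suc m) ∣ ]
  a-first-non-one m P≡1 ε-case =
    trans (exponent-recurrence m) (trans (cong (_-_ (ε (suc m))) (P≡1 (suc m))) (decrement ε-case))
    where
    decrement : ∀ {x} → x ≡ + 0 ⊎ x ≡ -[1+ 0 ] → x - + 1 ≡ -[1+ ∣ x ∣ ]
    decrement (inj₁ refl) = refl
    decrement (inj₂ refl) = refl

  P-first-non-one : ∀ m → (∀ n → P m n ≡ + 1) → (ε-case : ε (suc m) ≡ + 0 ⊎ ε (suc m) ≡ -[1+ 0 ]) →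
    ∀ n → suc m ℕ.< n → n ℕ.≤ suc m ℕ.+ suc m →
    P (suc m) n ≡ ε (suc m) + + ∣ ε (suc m) ∣ ℤ.* (X^ (suc m ℕ.+ suc m)) n
  P-first-non-one m P≡1 ε-case n t<n n≤2t with ε-case | a-first-non-one m P≡1 ε-case
  ... | inj₁ ε≡0 | a≡ = begin
    (P m ⊛ factor t (a t)) n             ≡⟨ cong (λ c → (P m ⊛ factor t c) n) (trans a≡ (cong (λ x → -[1+ ∣ x ∣ ]) ε≡0)) ⟩
    (P m ⊛ (oneMinus t ⊛ onePS)) n       ≡⟨ ⊛-congˡ (P m) (⊛-identityʳ (oneMinus t)) n ⟩
    (P m ⊛ oneMinus t) n                 ≡⟨ ⊛-comm (P m) (oneMinus t) n ⟩
    (oneMinus t ⊛ P m) n                 ≡⟨ oneMinus-⊛-ones-≥ (s≤s z≤n) P≡1 (ℕP.<⇒≤ t<n) ⟩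
    + 0                                  ≡⟨ cong (λ x → x + + ∣ x ∣ ℤ.* (X^ (t ℕ.+ t)) n) (sym ε≡0) ⟩
    ε t + + ∣ ε t ∣ ℤ.* (X^ (t ℕ.+ t)) n ∎
    where
    t : ℕ
    t = suc m
  ... | inj₂ ε≡-1 | a≡ = begin
    (P m ⊛ factor t (a t)) n             ≡⟨ cong (λ c → (P m ⊛ factor t c) n) (trans a≡ (cong (λ x → -[1+ ∣ x ∣ ]) ε≡-1)) ⟩
    (P m ⊛ (O ⊛ (O ⊛ onePS))) n          ≡⟨ ⊛-comm (P m) (O ⊛ (O ⊛ onePS)) n ⟩
    ((O ⊛ (O ⊛ onePS)) ⊛ P m) n          ≡⟨ ⊛-assoc O (O ⊛ onePS) (P m) n ⟩
    (O ⊛ ((O ⊛ onePS) ⊛ P m)) n          ≡⟨ ⊛-congˡ O (⊛-congʳ (P m) (⊛-identityʳ O)) n ⟩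
    (O ⊛ R) n                            ≡⟨ oneMinus-⊛-≤ R (s≤s z≤n) (ℕP.<⇒≤ t<n) ⟩
    R n - R (n ℕ.∸ t)                    ≡⟨ cong (_- R (n ℕ.∸ t)) (R-≥ (ℕP.<⇒≤ t<n)) ⟩
    + 0 - R (n ℕ.∸ t)                    ≡⟨ ℤP.+-identityˡ (- R (n ℕ.∸ t)) ⟩
    - R (n ℕ.∸ t)                        ≡⟨ top n≤2t ⟩
    -[1+ 0 ] + + 1 ℤ.* (X^ (t ℕ.+ t)) n  ≡⟨ cong (λ x → x + + ∣ x ∣ ℤ.* (X^ (t ℕ.+ t)) n) (sym ε≡-1) ⟩
    ε t + + ∣ ε t ∣ ℤ.* (X^ (t ℕ.+ t)) n ∎
    where
    t : ℕ
    t = suc m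
    O R : PS
    O = oneMinus t
    R = O ⊛ P m
    R-< : ∀ {i} → i ℕ.< t → R i ≡ + 1
    R-< = oneMinus-⊛-ones-< (s≤s z≤n) P≡1
    R-≥ : ∀ {i} → t ℕ.≤ i → R i ≡ + 0
    R-≥ = oneMinus-⊛-ones-≥ (s≤s z≤n) P≡1
    top : n ℕ.≤ t ℕ.+ t → - R (n ℕ.∸ t) ≡ -[1+ 0 ] + + 1 ℤ.* (X^ (t ℕ.+ t)) n
    top n≤2t with ℕP.m≤n⇒m<n∨m≡n n≤2t
    ... | inj₁ n<2t = trans (cong -_ (R-< (ℕP.m<n+o⇒m∸n<o n t n<2t)))
                            (sym (cong (λ x → -[1+ 0 ] + + 1 ℤ.* x) (X^-< n<2t)))
    ... | inj₂ refl = trans (cong (λ i → - R i) (ℕP.m+n∸m≡n t t))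
                            (trans (cong -_ (R-≥ ℕP.≤-refl)) (sym (cong (λ x → -[1+ 0 ] + + 1 ℤ.* x) (X^-self (t ℕ.+ t)))))

  module _ (k : ℕ) (c : ℤ) where

    Plateau : ℕ → Set
    Plateau m = ∀ n → m ℕ.< n → n ℕ.≤ k ℕ.+ k → P m n ≡ ε m + c ℤ.* (X^ (k ℕ.+ k)) n

    a-plateau : ∀ m → Plateau m → suc m ℕ.< k ℕ.+ k → a (suc m) ≡ ε (suc m) - ε m
    a-plateau m plateau 1+m<2k = begin
      a (suc m)                                          ≡⟨ exponent-recurrence m ⟩
      ε (suc m) - P m (suc m)                            ≡⟨ cong (_-_ (ε (suc m))) (plateau (suc m) ℕP.≤-refl (ℕP.<⇒≤ 1+m<2k)) ⟩
      ε (suc m) - (ε m + c ℤ.* (X^ (k ℕ.+ k)) (suc m))   ≡⟨ cong (λ x → ε (suc m) - (ε m + c ℤ.* x)) (X^-< 1+m<2k) ⟩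
      ε (suc m) - (ε m + c ℤ.* + 0)                      ≡⟨ cong (λ x → ε (suc m) - (ε m + x)) (ℤP.*-zeroʳ c) ⟩
      ε (suc m) - (ε m + + 0)                            ≡⟨ cong (λ x → ε (suc m) - x) (ℤP.+-identityʳ (ε m)) ⟩
      ε (suc m) - ε m ∎

    a-plateau-top : ∀ m → suc m ≡ k ℕ.+ k → Plateau m → a (suc m) ≡ ε (suc m) - ε m - c
    a-plateau-top m 1+m≡2k plateau = begin
      a (suc m)                                          ≡⟨ exponent-recurrence m ⟩
      ε (suc m) - P m (suc m)                            ≡⟨ cong (_-_ (ε (suc m))) (plateau (suc m) ℕP.≤-refl (ℕP.≤-reflexive 1+m≡2k)) ⟩
      ε (suc m) - (ε m + c ℤ.* (X^ (k ℕ.+ k)) (suc m))   ≡⟨ cong (λ x → ε (suc m) - (ε m + c ℤ.* x)) (trans (cong (X^ (k ℕ.+ k)) 1+m≡2k) (X^-self (k ℕ.+ k))) ⟩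
      ε (suc m) - (ε m + c ℤ.* + 1)                      ≡⟨ distribute (ε (suc m)) (ε m) c ⟩
      ε (suc m) - ε m - c ∎
      where
      distribute : ∀ x y c → x - (y + c ℤ.* + 1) ≡ x - y - c
      distribute = solve-∀

    module _ (series≡1 : ∀ i → i ℕ.< k → seriesOf ε i ≡ + 1) where

      plateau-suc : ∀ m → k ℕ.≤ m → suc m ℕ.< k ℕ.+ k → Plateau m → Plateau (suc m)
      plateau-suc m k≤m 1+m<2k plateau n 1+m<n n≤2k = begin
        P (suc m) n                                               ≡⟨ prodFactors-suc a m n<2+2m ⟩
        P m n + a (suc m) ℤ.* (X^ (suc m) ⊛ P m) n                ≡⟨ cong₂ (λ x y → x + a (suc m) ℤ.* y)
                                                                            (plateau n (ℕP.<-trans (ℕP.n<1+n m) 1+m<n) n≤2k)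
                                                                            (X^-⊛-≤ (P m) (ℕP.<⇒≤ 1+m<n)) ⟩
        (ε m + c ℤ.* Xn) + a (suc m) ℤ.* P m (n ℕ.∸ suc m)        ≡⟨ cong₂ (λ x y → (ε m + c ℤ.* Xn) + x ℤ.* y)
                                                                            (a-plateau m plateau 1+m<2k) low-coefficient ⟩
        (ε m + c ℤ.* Xn) + (ε (suc m) - ε m) ℤ.* + 1              ≡⟨ telescope (ε m) (ε (suc m)) (c ℤ.* Xn) ⟩
        ε (suc m) + c ℤ.* Xn ∎
        where
        Xn : ℤ
        Xn = (X^ (k ℕ.+ k)) n
        telescope : ∀ x y z → (x + z) + (y - x) ℤ.* + 1 ≡ y + z
        telescope = solve-∀
        n<2+2m : n ℕ.< suc m ℕ.+ suc m
        n<2+2m = ℕP.≤-<-trans (ℕP.≤-trans n≤2k (ℕP.+-mono-≤ k≤m k≤m)) (s≤s (ℕP.+-monoʳ-≤ m (ℕP.n≤1+n m)))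
        n∸1+m<k : n ℕ.∸ suc m ℕ.< k
        n∸1+m<k = subst (n ℕ.∸ suc m ℕ.<_) (ℕP.m+n∸m≡n (suc m) k)
                    (ℕP.∸-monoˡ-< (ℕP.≤-<-trans n≤2k (ℕP.+-monoˡ-< k (s≤s k≤m))) (ℕP.<⇒≤ 1+m<n))
        low-coefficient : P m (n ℕ.∸ suc m) ≡ + 1
        low-coefficient = trans (ex m (n ℕ.∸ suc m) (ℕP.<⇒≤ (ℕP.<-≤-trans n∸1+m<k k≤m))) (series≡1 _ n∸1+m<k)

      plateau-upto : Plateau k → ∀ m → k ℕ.≤ m → m ℕ.< k ℕ.+ k → Plateau m
      plateau-upto plateau-k (suc m) k≤1+m 1+m<2k with ℕP.m≤n⇒m<n∨m≡n k≤1+m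
      ... | inj₂ refl       = plateau-k
      ... | inj₁ (s≤s k≤m) =
        plateau-suc m k≤m 1+m<2k (plateau-upto plateau-k m k≤m (ℕP.<-trans (ℕP.n<1+n m) 1+m<2k))
      plateau-upto plateau-k zero z≤n ()

      a-between : Plateau k → ∀ j → k ℕ.< j → j ℕ.< k ℕ.+ k → a j ≡ ε j - ε (j ℕ.∸ 1)
      a-between plateau-k (suc m) (s≤s k≤m) j<2k =
        a-plateau m (plateau-upto plateau-k m k≤m (ℕP.<-trans (ℕP.n<1+n m) j<2k)) j<2k

      a-double : 1 ℕ.≤ k → Plateau k → a (k ℕ.+ k) ≡ ε (k ℕ.+ k) - ε (k ℕ.+ k ℕ.∸ 1) - c
      a-double 1≤k plateau-k =
        subst (λ N → a N ≡ ε N - ε (N ℕ.∸ 1) - c) 1+m≡2k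
              (a-plateau-top m 1+m≡2k (plateau-upto plateau-k m k≤m (subst (m ℕ.<_) 1+m≡2k ℕP.≤-refl)))
        where
        m : ℕ
        m = k ℕ.+ k ℕ.∸ 1
        1+m≡2k : suc m ≡ k ℕ.+ k
        1+m≡2k = ℕP.m+[n∸m]≡n (ℕP.≤-trans 1≤k (ℕP.m≤m+n k k))
        k≤m : k ℕ.≤ m
        k≤m = ℕP.≤-pred (subst (suc k ℕ.≤_) (sym 1+m≡2k) (subst (ℕ._≤ k ℕ.+ k) (ℕP.+-comm k 1) (ℕP.+-monoʳ-≤ k 1≤k)))

sign-≢1 : ∀ {ε j} → IsSignSeq ε → 1 ℕ.≤ j → ε j ≢ + 1 → ε j ≡ + 0 ⊎ ε j ≡ -[1+ 0 ]
sign-≢1 {j = j} signs 1≤j εj≢1 with signs j 1≤j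
... | inj₁ εj≡-1        = inj₂ εj≡-1
... | inj₂ (inj₁ εj≡0) = inj₁ εj≡0
... | inj₂ (inj₂ εj≡1) = ⊥-elim (εj≢1 εj≡1)

proposition2p8 :
    (ε : ℕ → ℤ) → InF ε → PowerfreeType ε →
    (k : ℕ) → 1 ℕ.≤ k → ε k ≢ + 1 → (∀ j → 1 ℕ.≤ j → j ℕ.< k → ε j ≡ + 1) →
    (a : ℕ → ℤ) → IsExponentSeq ε a →
    IsCriticalIndex a k
    × a 1 ≡ + 1
    × (∀ j → 2 ℕ.≤ j → j ℕ.< k → a j ≡ + 0)
    × a k ≡ -[1+ ∣ ε k ∣ ]
    × (∀ j → k ℕ.< j → j ℕ.< 2 * k → a j ≡ ε j ℤ.- ε (j ℕ.∸ 1))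
    × a (2 * k) ≡ ε (2 * k) ℤ.- ε (2 * k ℕ.∸ 1) ℤ.- + ∣ ε k ∣
    × ((η : ℕ → ℤ) → IsTailFactorization ε a (2 * k) η →
       ∃[ A ] ∃[ B ] (1 ℕ.≤ A × 1 ℕ.≤ B
         × (∀ j → 2 * k ℕ.< j → ∣ η j ∣ ℕ.≤ (A * j) ^ B)))
proposition2p8 ε _ _ zero () _ _ _ _
proposition2p8 ε _ ε₁≡1 (suc zero) _ ε₁≢1 _ _ _ = ⊥-elim (ε₁≢1 ε₁≡1)
proposition2p8 ε (signs , _) ε₁≡1 k@(suc m@(suc m′)) 1≤k εk≢1 ε≡1 a ex =
  (1≤k , a-k-negative , a-nonnegative-below) , a-1 ε₁≡1 , a-below k ε≡1 , a-k ,
  (λ j k<j j<2k → a-between k c series≡1 plateau-k j k<j (subst (j ℕ.<_) 2k≡k+k j<2k)) ,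
  subst (λ N → a N ≡ ε N - ε (N ℕ.∸ 1) - c) (sym 2k≡k+k) (a-double k c series≡1 1≤k plateau-k) ,
  λ η → tail-coefficients-bounded a (2 * k) η signs
  where
  open ExponentSequence ε a ex
  c : ℤ
  c = + ∣ ε k ∣
  εk-case : ε k ≡ + 0 ⊎ ε k ≡ -[1+ 0 ]
  εk-case = sign-≢1 signs 1≤k εk≢1
  P-ones-m : ∀ n → P m n ≡ + 1
  P-ones-m = P-ones k ε≡1 m′ ℕP.≤-refl
  a-k : a k ≡ -[1+ ∣ ε k ∣ ]
  a-k = a-first-non-one m P-ones-m εk-case
  a-k-negative : a k ℤ.< + 0
  a-k-negative = subst (ℤ._< + 0) (sym a-k) ℤ.-<+
  a-nonnegative-below : ∀ j → 1 ℕ.≤ j → j ℕ.< k → + 0 ℤ.≤ a j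
  a-nonnegative-below (suc zero)    _ _   = subst (+ 0 ℤ.≤_) (sym (a-1 ε₁≡1)) (ℤ.+≤+ z≤n)
  a-nonnegative-below (suc (suc j)) _ j<k = subst (+ 0 ℤ.≤_) (sym (a-below k ε≡1 (suc (suc j)) (s≤s (s≤s z≤n)) j<k)) ℤP.≤-refl
  series≡1 : ∀ i → i ℕ.< k → seriesOf ε i ≡ + 1
  series≡1 zero    _   = refl
  series≡1 (suc i) i<k = ε≡1 (suc i) (s≤s z≤n) i<k
  plateau-k : Plateau k c k
  plateau-k = P-first-non-one m P-ones-m εk-case
  2k≡k+k : 2 * k ≡ k ℕ.+ k
  2k≡k+k = cong (k ℕ.+_) (ℕP.+-identityʳ k)
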